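{- Let $G=(V,E)$ be a connected graph with a fixed spanning tree $T$ and a given vertex $u$, and let $\alpha,\beta$ be two proper 3-colourings of $G$. For any $(\alpha\to\beta)$-recolouring $R=c_0,\dots,c_\ell$, for each vertex $v\in V$ and each $i$ with $0\le i\le\ell$, $$2(\alpha(v)-c_i(v))\equiv H_u^R(c_i,v)\pmod 6.$$
   Context: A proper 3-colouring is a map $c:V\to\{1,2,3\}$ with $c(x)\ne c(y)$ for all $xy\in E$. A $(c_0\to c_\ell)$-recolouring is a sequence $c_0,\dots,c_\ell$ of proper 3-colourings in which consecutive colourings disagree on at most one vertex. For an edge oriented from $x$ to $y$, $w(c,\overrightarrow{xy})\in\{ -1,1\}$ satisfies $w(c,\overrightarrow{xy})\equiv c(y)-c(x)\pmod 3$; path weights are sums of edge weights; $\overrightarrow{P_{uv}}$ is the $u$–$v$ path in $T$ oriented from $u$ to $v$; $h_{\alpha,u}(c,v)=w(c,\overrightarrow{P_{uv}})-w(\alpha,\overrightarrow{P_{uv}})$. Absolute heights (indexed by position $i$): $H_u^R(c_0,u)=0$; for $i>0$, $H_u^R(c_i,u)=H_u^R(c_{i-1},u)$ if $c_i(u)=c_{i-1}(u)$, $=H_u^R(c_{i-1},u)+2$ if $c_i(u)\equiv c_{i-1}(u)-1\pmod3$, $=H_u^R(c_{i-1},u)-2$ if $c_i(u)\equiv c_{i-1}(u)+1\pmod3$; and $H_u^R(c_i,v)=H_u^R(c_i,u)+h_{\alpha,u}(c_i,v)$. -}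

module Defs where

open import Level using (0ℓ)
open import Data.Nat as ℕ using (ℕ; zero; suc; _≤_; _<_)
open import Data.Integer as ℤ using (ℤ; +_; -_; _-_; _+_; _*_)
open import Data.Integer.Divisibility using (_∣_)
open import Data.Fin using (Fin; toℕ)
import Data.Fin as F
open import Data.List using (List; []; _∷_)
open import Data.List.Relation.Unary.Unique.Propositional using (Unique)
open import Data.Product using (Σ; ∃; _×_)
open import Data.Empty using (⊥)
open import Relation.Nullary using (¬_; yes; no)
open import Relation.Binary.PropositionalEquality using (_≡_; _≢_)

-- Colours {1,2,3} are represented by Fin 3 = {0,1,2} (colour k+1 ↦ k);
-- only differences mod 3 matter.
Colour : Set
Colour = Fin 3

col : Colour → ℤ
col a = + toℕ a

record Graph (n : ℕ) : Set₁ where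
  field
    Adj   : Fin n → Fin n → Set
    sym   : ∀ {x y} → Adj x y → Adj y x
    irrefl : ∀ {x} → ¬ Adj x x
open Graph public

data Walk {n : ℕ} (G : Graph n) : Fin n → Fin n → Set where
  [] : ∀ {x} → Walk G x x
  _∷_ : ∀ {x y z} → Adj G x y → Walk G y z → Walk G x z

walkLength : ∀ {n} {G : Graph n} {x y} → Walk G x y → ℕ
walkLength [] = 0
walkLength (_ ∷ p) = suc (walkLength p)

vertices : ∀ {n} {G : Graph n} {x y} → Walk G x y → List (Fin n)
vertices {x = x} [] = x ∷ []
vertices {x = x} (_ ∷ p) = x ∷ vertices p

IsPath : ∀ {n} {G : Graph n} {x y} → Walk G x y → Set
IsPath p = Unique (vertices p)

Connected : ∀ {n} → Graph n → Set
Connected G = ∀ x y → Walk G x y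

-- Acyclic: there is no cycle x y ... x (edge xy followed by a path from y
-- back to x of length ≥ 2), i.e. no cycle of length ≥ 3.
Acyclic : ∀ {n} → Graph n → Set
Acyclic G = ∀ {x y} (e : Adj G x y) (p : Walk G y x) → IsPath p → 2 ≤ walkLength p → ⊥

IsSpanningTree : ∀ {n} → Graph n → Graph n → Set
IsSpanningTree G T = (∀ {x y} → Adj T x y → Adj G x y) × Connected T × Acyclic T

Colouring : ℕ → Set
Colouring n = Fin n → Colour

Proper : ∀ {n} → Graph n → Colouring n → Set
Proper G c = ∀ {x y} → Adj G x y → c x ≢ c y

-- (α → β)-recolouring c_0,…,c_ℓ, represented by ℓ and a sequence c : ℕ → Colouring n
-- (only the entries with index ≤ ℓ matter).
IsRecolouring : ∀ {n} → Graph n → Colouring n → Colouring n → (ℓ : ℕ) → (ℕ → Colouring n) → Set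
IsRecolouring {n} G α β ℓ c =
  (∀ x → c 0 x ≡ α x) ×
  (∀ x → c ℓ x ≡ β x) ×
  (∀ i → i ≤ ℓ → Proper G (c i)) ×
  (∀ i → i < ℓ → ∃ λ (z : Fin n) → ∀ x → x ≢ z → c i x ≡ c (suc i) x)

succ3 : Colour → Colour
succ3 F.zero = F.suc F.zero
succ3 (F.suc F.zero) = F.suc (F.suc F.zero)
succ3 (F.suc (F.suc F.zero)) = F.zero

pred3 : Colour → Colour
pred3 a = succ3 (succ3 a)

-- Weight of an oriented edge x→y: the value in {-1,1} congruent to c(y)-c(x) mod 3
-- (for a proper colouring c(y) ≠ c(x), so c(y) is c(x)+1 or c(x)-1 mod 3).
edgeWeight : ∀ {n} → Colouring n → Fin n → Fin n → ℤ
edgeWeight c x y with c y F.≟ succ3 (c x)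
... | yes _ = + 1
... | no _ = - (+ 1)

walkWeight : ∀ {n} {G : Graph n} → Colouring n → ∀ {x y} → Walk G x y → ℤ
walkWeight c [] = + 0
walkWeight c (_∷_ {x} {y} _ p) = edgeWeight c x y + walkWeight c p

heightStep : Colour → Colour → ℤ
heightStep a b with b F.≟ a | b F.≟ pred3 a
... | yes _ | _ = + 0
... | no _ | yes _ = + 2
... | no _ | no _ = - (+ 2)

heightRoot : ∀ {n} → (ℕ → Colouring n) → Fin n → ℕ → ℤ
heightRoot c u zero = + 0
heightRoot c u (suc i) = heightRoot c u i + heightStep (c i u) (c (suc i) u)

relHeight : ∀ {n} {T : Graph n} → Colouring n → Colouring n → ∀ {u v} → Walk T u v → ℤ
relHeight α c P = walkWeight c P - walkWeight α P

-- H_u^R(c_i, v) = H_u^R(c_i,u) + h_{α,u}(c_i,v), with P the u–v path in T.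
height : ∀ {n} {T : Graph n} → (ℕ → Colouring n) → Colouring n → ∀ {u v} → Walk T u v → ℕ → ℤ
height c α {u} P i = heightRoot c u i + relHeight α (c i) P

-- Modulo 6 every quantity in a height is a difference of the potential 2·c(x):
-- an edge weight is the odd number congruent to c(y) − c(x) mod 3, hence
-- w(c, xy) ≡ 3 + 2(c(x) − c(y)), and a height step of u is ≡ 2(c_{i−1}(u) − c_i(u)).
-- Summing, H(c_i, u) ≡ 2(α(u) − c_i(u)), while along any walk from u to v the
-- 3·length terms of w(c_i, P) and w(α, P) cancel in h_{α,u}(c_i, v), leaving
-- 2(c_i(u) − α(u)) − 2(c_i(v) − α(v)).
module Submission where

open import Defs
open import Level using (0ℓ)
open import Data.Nat using (ℕ; zero; suc; _≤_)
open import Data.Integer using (ℤ; +_; -_; _+_; _*_; _-_)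
open import Data.Integer.Divisibility using (_∣_)
open import Data.Integer.Divisibility.Signed as Signed
  using (divides; ∣m∣n⇒∣m+n; ∣m⇒∣-m; ∣⇒∣ᵤ)
open import Data.Integer.Tactic.RingSolver using (solve-∀)
open import Data.Fin using (Fin)
import Data.Fin as F
open import Data.Product using (_,_)
open import Data.Empty using (⊥-elim)
open import Relation.Nullary using (yes; no)
open import Relation.Binary.Bundles using (Setoid)
open import Relation.Binary.Structures using (IsEquivalence)
import Relation.Binary.Reasoning.Setoid as SetoidReasoning
open import Relation.Binary.PropositionalEquality using (_≡_; _≢_; refl; cong; subst)

infix 4 _≡_[mod_]

record _≡_[mod_] (a b m : ℤ) : Set where
  constructor from-∣
  field to-∣ : m Signed.∣ a - b
open _≡_[mod_]

module _ {m : ℤ} where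

  mod-refl : ∀ {a} → a ≡ a [mod m ]
  mod-refl {a} = from-∣ (divides (+ 0) (a-a≡0*m a))
    where
    a-a≡0*m : ∀ a → a - a ≡ + 0 * m
    a-a≡0*m = solve-∀

  mod-reflexive : ∀ {a b} → a ≡ b → a ≡ b [mod m ]
  mod-reflexive refl = mod-refl

  mod-sym : ∀ {a b} → a ≡ b [mod m ] → b ≡ a [mod m ]
  mod-sym {a} {b} a≡b = from-∣ (subst (m Signed.∣_) (-[a-b]≡b-a a b) (∣m⇒∣-m (to-∣ a≡b)))
    where
    -[a-b]≡b-a : ∀ a b → - (a - b) ≡ b - a
    -[a-b]≡b-a = solve-∀

  mod-trans : ∀ {a b c} → a ≡ b [mod m ] → b ≡ c [mod m ] → a ≡ c [mod m ]
  mod-trans {a} {b} {c} a≡b b≡c =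
    from-∣ (subst (m Signed.∣_) ([a-b]+[b-c]≡a-c a b c) (∣m∣n⇒∣m+n (to-∣ a≡b) (to-∣ b≡c)))
    where
    [a-b]+[b-c]≡a-c : ∀ a b c → (a - b) + (b - c) ≡ a - c
    [a-b]+[b-c]≡a-c = solve-∀

  mod-+-cong : ∀ {a b c d} → a ≡ b [mod m ] → c ≡ d [mod m ] → a + c ≡ b + d [mod m ]
  mod-+-cong {a} {b} {c} {d} a≡b c≡d =
    from-∣ (subst (m Signed.∣_) ([a-b]+[c-d]≡[a+c]-[b+d] a b c d)
                  (∣m∣n⇒∣m+n (to-∣ a≡b) (to-∣ c≡d)))
    where
    [a-b]+[c-d]≡[a+c]-[b+d] : ∀ a b c d → (a - b) + (c - d) ≡ (a + c) - (b + d)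
    [a-b]+[c-d]≡[a+c]-[b+d] = solve-∀

  mod-−-cong : ∀ {a b c d} → a ≡ b [mod m ] → c ≡ d [mod m ] → a - c ≡ b - d [mod m ]
  mod-−-cong {a} {b} {c} {d} a≡b c≡d =
    from-∣ (subst (m Signed.∣_) ([a-b]-[c-d]≡[a-c]-[b-d] a b c d)
                  (∣m∣n⇒∣m+n (to-∣ a≡b) (∣m⇒∣-m (to-∣ c≡d))))
    where
    [a-b]-[c-d]≡[a-c]-[b-d] : ∀ a b c d → (a - b) - (c - d) ≡ (a - c) - (b - d)
    [a-b]-[c-d]≡[a-c]-[b-d] = solve-∀

  mod-isEquivalence : IsEquivalence _≡_[mod m ]
  mod-isEquivalence = record { refl = mod-refl ; sym = mod-sym ; trans = mod-trans }

mod-setoid : ℤ → Setoid 0ℓ 0ℓ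
mod-setoid m = record { isEquivalence = mod-isEquivalence {m} }

heightStep≡2*[a-b] : ∀ a b → heightStep a b ≡ + 2 * (col a - col b) [mod + 6 ]
heightStep≡2*[a-b] F.zero                  F.zero                  = from-∣ (divides (+ 0) refl)
heightStep≡2*[a-b] F.zero                  (F.suc F.zero)          = from-∣ (divides (+ 0) refl)
heightStep≡2*[a-b] F.zero                  (F.suc (F.suc F.zero))  = from-∣ (divides (+ 1) refl)
heightStep≡2*[a-b] (F.suc F.zero)          F.zero                  = from-∣ (divides (+ 0) refl)
heightStep≡2*[a-b] (F.suc F.zero)          (F.suc F.zero)          = from-∣ (divides (+ 0) refl)
heightStep≡2*[a-b] (F.suc F.zero)          (F.suc (F.suc F.zero))  = from-∣ (divides (+ 0) refl)
heightStep≡2*[a-b] (F.suc (F.suc F.zero))  F.zero                  = from-∣ (divides (- + 1) refl)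
heightStep≡2*[a-b] (F.suc (F.suc F.zero))  (F.suc F.zero)          = from-∣ (divides (+ 0) refl)
heightStep≡2*[a-b] (F.suc (F.suc F.zero))  (F.suc (F.suc F.zero))  = from-∣ (divides (+ 0) refl)

ascent≡3+2*[a-b] : ∀ a b → b ≡ succ3 a → + 1 ≡ + 3 + + 2 * (col a - col b) [mod + 6 ]
ascent≡3+2*[a-b] F.zero                 _ refl = from-∣ (divides (+ 0) refl)
ascent≡3+2*[a-b] (F.suc F.zero)         _ refl = from-∣ (divides (+ 0) refl)
ascent≡3+2*[a-b] (F.suc (F.suc F.zero)) _ refl = from-∣ (divides (- + 1) refl)

descent≡3+2*[a-b] : ∀ a b → a ≢ b → b ≢ succ3 a → - + 1 ≡ + 3 + + 2 * (col a - col b) [mod + 6 ]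
descent≡3+2*[a-b] F.zero                 F.zero                 a≢b _    = ⊥-elim (a≢b refl)
descent≡3+2*[a-b] F.zero                 (F.suc F.zero)         _   b≢a⁺ = ⊥-elim (b≢a⁺ refl)
descent≡3+2*[a-b] F.zero                 (F.suc (F.suc F.zero)) _   _    = from-∣ (divides (+ 0) refl)
descent≡3+2*[a-b] (F.suc F.zero)         F.zero                 _   _    = from-∣ (divides (- + 1) refl)
descent≡3+2*[a-b] (F.suc F.zero)         (F.suc F.zero)         a≢b _    = ⊥-elim (a≢b refl)
descent≡3+2*[a-b] (F.suc F.zero)         (F.suc (F.suc F.zero)) _   b≢a⁺ = ⊥-elim (b≢a⁺ refl)
descent≡3+2*[a-b] (F.suc (F.suc F.zero)) F.zero                 _   b≢a⁺ = ⊥-elim (b≢a⁺ refl)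
descent≡3+2*[a-b] (F.suc (F.suc F.zero)) (F.suc F.zero)         _   _    = from-∣ (divides (- + 1) refl)
descent≡3+2*[a-b] (F.suc (F.suc F.zero)) (F.suc (F.suc F.zero)) a≢b _    = ⊥-elim (a≢b refl)

edgeWeight≡3+2*[cx-cy] : ∀ {n} (c : Colouring n) x y → c x ≢ c y →
  edgeWeight c x y ≡ + 3 + + 2 * (col (c x) - col (c y)) [mod + 6 ]
edgeWeight≡3+2*[cx-cy] c x y cx≢cy with c y F.≟ succ3 (c x)
... | yes cy≡cx⁺ = ascent≡3+2*[a-b] (c x) (c y) cy≡cx⁺
... | no  cy≢cx⁺ = descent≡3+2*[a-b] (c x) (c y) cx≢cy cy≢cx⁺

walkWeight≡3*length+2*[cx-cy] : ∀ {n} {G : Graph n} (c : Colouring n) → Proper G c →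
  ∀ {x y} (P : Walk G x y) →
  walkWeight c P ≡ + 3 * + walkLength P + + 2 * (col (c x) - col (c y)) [mod + 6 ]
walkWeight≡3*length+2*[cx-cy] c _ {x} [] = mod-reflexive (0≡3*0+2*[a-a] (col (c x)))
  where
  0≡3*0+2*[a-a] : ∀ a → + 0 ≡ + 3 * + 0 + + 2 * (a - a)
  0≡3*0+2*[a-a] = solve-∀
walkWeight≡3*length+2*[cx-cy] c proper {x} {z} (_∷_ {y = y} xy P) = begin
  edgeWeight c x y + walkWeight c P
    ≈⟨ mod-+-cong (edgeWeight≡3+2*[cx-cy] c x y (proper xy))
                  (walkWeight≡3*length+2*[cx-cy] c proper P) ⟩
  (+ 3 + + 2 * (col (c x) - col (c y))) + (+ 3 * + walkLength P + + 2 * (col (c y) - col (c z)))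
    ≡⟨ telescope (col (c x)) (col (c y)) (col (c z)) (+ walkLength P) ⟩
  + 3 * (+ 1 + + walkLength P) + + 2 * (col (c x) - col (c z)) ∎
  where
  open SetoidReasoning (mod-setoid (+ 6))
  telescope : ∀ a b d l → (+ 3 + + 2 * (a - b)) + (+ 3 * l + + 2 * (b - d)) ≡ + 3 * (+ 1 + l) + + 2 * (a - d)
  telescope = solve-∀

heightRoot≡2*[c₀u-cᵢu] : ∀ {n} (c : ℕ → Colouring n) u i →
  heightRoot c u i ≡ + 2 * (col (c 0 u) - col (c i u)) [mod + 6 ]
heightRoot≡2*[c₀u-cᵢu] c u zero = mod-reflexive (0≡2*[a-a] (col (c 0 u)))
  where
  0≡2*[a-a] : ∀ a → + 0 ≡ + 2 * (a - a)
  0≡2*[a-a] = solve-∀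
heightRoot≡2*[c₀u-cᵢu] c u (suc i) = begin
  heightRoot c u i + heightStep (c i u) (c (suc i) u)
    ≈⟨ mod-+-cong (heightRoot≡2*[c₀u-cᵢu] c u i) (heightStep≡2*[a-b] (c i u) (c (suc i) u)) ⟩
  + 2 * (col (c 0 u) - col (c i u)) + + 2 * (col (c i u) - col (c (suc i) u))
    ≡⟨ telescope (col (c 0 u)) (col (c i u)) (col (c (suc i) u)) ⟩
  + 2 * (col (c 0 u) - col (c (suc i) u)) ∎
  where
  open SetoidReasoning (mod-setoid (+ 6))
  telescope : ∀ a b d → + 2 * (a - b) + + 2 * (b - d) ≡ + 2 * (a - d)
  telescope = solve-∀

height≡2*[αv-cᵢv] : ∀ {n} {T : Graph n} (α : Colouring n) → Proper T α →
  (c : ℕ → Colouring n) → (∀ x → c 0 x ≡ α x) → ∀ i → Proper T (c i) →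
  ∀ {u v} (P : Walk T u v) → height c α P i ≡ + 2 * (col (α v) - col (c i v)) [mod + 6 ]
height≡2*[αv-cᵢv] α α-proper c c₀≡α i cᵢ-proper {u} {v} P = begin
  heightRoot c u i + (walkWeight (c i) P - walkWeight α P)
    ≈⟨ mod-+-cong (heightRoot≡2*[c₀u-cᵢu] c u i)
         (mod-−-cong (walkWeight≡3*length+2*[cx-cy] (c i) cᵢ-proper P)
                     (walkWeight≡3*length+2*[cx-cy] α α-proper P)) ⟩
  + 2 * (col (c 0 u) - col (c i u)) + weightDifference
    ≡⟨ cong (λ a → + 2 * (col a - col (c i u)) + weightDifference) (c₀≡α u) ⟩
  + 2 * (col (α u) - col (c i u)) + weightDifference
    ≡⟨ lengths-cancel (col (α u)) (col (c i u)) (col (c i v)) (col (α v)) L ⟩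
  + 2 * (col (α v) - col (c i v)) ∎
  where
  open SetoidReasoning (mod-setoid (+ 6))
  L : ℤ
  L = + walkLength P
  weightDifference : ℤ
  weightDifference = (+ 3 * L + + 2 * (col (c i u) - col (c i v))) - (+ 3 * L + + 2 * (col (α u) - col (α v)))
  lengths-cancel : ∀ a b d e l →
    + 2 * (a - b) + ((+ 3 * l + + 2 * (b - d)) - (+ 3 * l + + 2 * (a - e))) ≡ + 2 * (e - d)
  lengths-cancel = solve-∀

lemma9 : ∀ {n} (G T : Graph n) → Connected G → IsSpanningTree G T →
    (u : Fin n) (α β : Colouring n) → Proper G α → Proper G β →
    (ℓ : ℕ) (c : ℕ → Colouring n) → IsRecolouring G α β ℓ c →
    ∀ (v : Fin n) (P : Walk T u v) → IsPath P →
    ∀ i → i ≤ ℓ →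
    (+ 6) ∣ ((+ 2) * (col (α v) - col (c i v)) - height c α P i)
lemma9 G T _ (T⊆G , _) u α β α-proper _ ℓ c (c₀≡α , _ , cᵢ-proper , _) v P _ i i≤ℓ =
  ∣⇒∣ᵤ (to-∣ (mod-sym
    (height≡2*[αv-cᵢv] α (restrict α-proper) c c₀≡α i (restrict (cᵢ-proper i i≤ℓ)) P)))
  where
  restrict : ∀ {γ} → Proper G γ → Proper T γ
  restrict γ-proper xy = γ-proper (T⊆G xy)
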